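{- Let $T$ be a Kock–Zöberlein monad on a poset-enriched category $\mathcal{A}$ and let $a\colon T(X)\to X$ be a $T$-algebra. Then on $T(X)$ there is a chain of (co)reflections $T(a)\dashv T(\eta_X)\dashv\mu_X\dashv\eta_{T(X)}$ between $T^2(X)$ and $T(X)$; explicitly $T(a)\circ T(\eta_X)=\mathrm{id}$, $\mathrm{id}\le T(\eta_X)\circ T(a)$, $\mu_X\circ T(\eta_X)=\mathrm{id}$, $T(\eta_X)\circ\mu_X\le\mathrm{id}$, $\mu_X\circ\eta_{T(X)}=\mathrm{id}$, $\mathrm{id}\le\eta_{T(X)}\circ\mu_X$. Here $\mu_X$ is a $T$-algebra, $T(\eta_X)$ is a $\overline{T}$-coalgebra on it and $T(a)$ is a $\overline{\overline{T}}$-algebra on that coalgebra, and this yields a functor $T\colon\mathrm{Alg}(T)\to\mathrm{Alg}(\overline{\overline{T}})$.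
   Context: A poset-enriched category has posets as hom-sets with monotone composition; $f\dashv g$ means $\mathrm{id}\le g\circ f$ and $f\circ g\le\mathrm{id}$. A monad $T=(T,\eta,\mu)$ is Kock–Zöberlein if $T$ is monotone on hom-sets and $T(\eta_X)\le\eta_{T(X)}$. $\mathrm{Alg}(T)$ is the Eilenberg–Moore category; the induced comonad $\overline{T}$ on $\mathrm{Alg}(T)$ sends $a\colon TX\to X$ to $\mu_X$, with counit $a$ and comultiplication $T(\eta_X)$; a $\overline{T}$-coalgebra on $a$ is $c\colon X\to TX$ with $c\circ a=\mu_X\circ T(c)$, $a\circ c=\mathrm{id}$, $T(\eta_X)\circ c=T(c)\circ c$. The monad $\overline{\overline{T}}$ on $\mathrm{CoAlg}(\overline{T})$ is induced by the forgetful functor to $\mathrm{Alg}(T)$ and its right adjoint; for $c$ on $a$, $\overline{\overline{T}}(c)$ is the coalgebra $T(\eta_X)$ on $\mu_X$, with unit $c$ and multiplication $T(a)$. A $\overline{\overline{T}}$-algebra on $c$ is a map $b\colon TX\to X$ with $a\circ T(b)=b\circ\mu_X$, $c\circ b=T(b)\circ T(\eta_X)$, $b\circ c=\mathrm{id}$, $b\circ T(b)=b\circ T(a)$. The functor sends $a$ to the $\overline{\overline{T}}$-algebra $T(a)$ on the coalgebra $T(\eta_X)$ on $\mu_X$, and an algebra map $f$ to $T(f)$. -}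

module Defs where

open import Level using (Level; _⊔_; suc)
open import Relation.Binary.PropositionalEquality using (_≡_)
open import Data.Product using (_×_)

record PosetCategory (o h r : Level) : Set (suc (o ⊔ h ⊔ r)) where
  infixr 9 _∘_
  infix 4 _≤_
  field
    Obj  : Set o
    Hom  : Obj → Obj → Set h
    id   : ∀ {A} → Hom A A
    _∘_  : ∀ {A B C} → Hom B C → Hom A B → Hom A C
    idˡ  : ∀ {A B} (f : Hom A B) → id ∘ f ≡ f
    idʳ  : ∀ {A B} (f : Hom A B) → f ∘ id ≡ f
    assoc : ∀ {A B C D} (h : Hom C D) (g : Hom B C) (f : Hom A B) →
            (h ∘ g) ∘ f ≡ h ∘ (g ∘ f)
    _≤_  : ∀ {A B} → Hom A B → Hom A B → Set r
    ≤-refl  : ∀ {A B} {f : Hom A B} → f ≤ f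
    ≤-trans : ∀ {A B} {f g k : Hom A B} → f ≤ g → g ≤ k → f ≤ k
    ≤-antisym : ∀ {A B} {f g : Hom A B} → f ≤ g → g ≤ f → f ≡ g
    ∘-mono : ∀ {A B C} {g g′ : Hom B C} {f f′ : Hom A B} →
             g ≤ g′ → f ≤ f′ → g ∘ f ≤ g′ ∘ f′

module _ {o h r} (𝒜 : PosetCategory o h r) where
  open PosetCategory 𝒜

  record _⊣_ {A B : Obj} (f : Hom A B) (g : Hom B A) : Set r where
    field
      unit   : id ≤ g ∘ f
      counit : f ∘ g ≤ id

  record Monad : Set (o ⊔ h) where
    field
      T₀   : Obj → Obj
      T₁   : ∀ {A B} → Hom A B → Hom (T₀ A) (T₀ B)
      T-id : ∀ {A} → T₁ (id {A}) ≡ id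
      T-∘  : ∀ {A B C} (g : Hom B C) (f : Hom A B) → T₁ (g ∘ f) ≡ T₁ g ∘ T₁ f
      η    : ∀ A → Hom A (T₀ A)
      μ    : ∀ A → Hom (T₀ (T₀ A)) (T₀ A)
      η-nat : ∀ {A B} (f : Hom A B) → η B ∘ f ≡ T₁ f ∘ η A
      μ-nat : ∀ {A B} (f : Hom A B) → μ B ∘ T₁ (T₁ f) ≡ T₁ f ∘ μ A
      μ-ηˡ  : ∀ A → μ A ∘ η (T₀ A) ≡ id
      μ-ηʳ  : ∀ A → μ A ∘ T₁ (η A) ≡ id
      μ-assoc : ∀ A → μ A ∘ T₁ (μ A) ≡ μ A ∘ μ (T₀ A)

  record IsKZ (M : Monad) : Set (o ⊔ h ⊔ r) where
    open Monad M
    field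
      T-mono : ∀ {A B} {f g : Hom A B} → f ≤ g → T₁ f ≤ T₁ g
      Tη≤ηT  : ∀ A → T₁ (η A) ≤ η (T₀ A)

  module _ (M : Monad) where
    open Monad M

    record IsAlg (X : Obj) (a : Hom (T₀ X) X) : Set h where
      field
        alg-unit  : a ∘ η X ≡ id
        alg-assoc : a ∘ T₁ a ≡ a ∘ μ X

    IsAlgMap : ∀ {X Z} (a : Hom (T₀ X) X) (b : Hom (T₀ Z) Z) (f : Hom X Z) → Set h
    IsAlgMap a b f = f ∘ a ≡ b ∘ T₁ f

    record IsCoalg̅ (X : Obj) (a : Hom (T₀ X) X) (c : Hom X (T₀ X)) : Set h where
      field
        coalg-hom    : c ∘ a ≡ μ X ∘ T₁ c
        coalg-counit : a ∘ c ≡ id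
        coalg-comult : T₁ (η X) ∘ c ≡ T₁ c ∘ c

    IsCoalg̅Map : ∀ {X Z} (a : Hom (T₀ X) X) (c : Hom X (T₀ X))
                 (a′ : Hom (T₀ Z) Z) (c′ : Hom Z (T₀ Z)) (g : Hom X Z) → Set h
    IsCoalg̅Map a c a′ c′ g = IsAlgMap a a′ g × (c′ ∘ g ≡ T₁ g ∘ c)

    record IsAlg̿ (X : Obj) (a : Hom (T₀ X) X) (c : Hom X (T₀ X))
                 (b : Hom (T₀ X) X) : Set h where
      field
        alg̿-hom₁ : a ∘ T₁ b ≡ b ∘ μ X
        alg̿-hom₂ : c ∘ b ≡ T₁ b ∘ T₁ (η X)
        alg̿-unit  : b ∘ c ≡ id
        alg̿-assoc : b ∘ T₁ b ≡ b ∘ T₁ a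

    IsAlg̿Map : ∀ {X Z} (a : Hom (T₀ X) X) (c : Hom X (T₀ X)) (b : Hom (T₀ X) X)
               (a′ : Hom (T₀ Z) Z) (c′ : Hom Z (T₀ Z)) (b′ : Hom (T₀ Z) Z)
               (g : Hom X Z) → Set h
    IsAlg̿Map a c b a′ c′ b′ g = IsCoalg̅Map a c a′ c′ g × (g ∘ b ≡ b′ ∘ T₁ g)

module Submission where

open import Defs
open import Level using (Level)
open import Relation.Binary.PropositionalEquality
  using (_≡_; refl; sym; cong; subst₂; module ≡-Reasoning)
open import Data.Product using (_×_; _,_)

-- In a Kock–Zöberlein monad every algebra a is reflective, a ⊣ η_X:
-- id = T(a) ∘ T(η_X) ≤ T(a) ∘ η_{T X} = η_X ∘ a.  The chain of adjunctions
-- then consists of T applied to this one (T preserves ⊣ as it is locally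
-- monotone), the same fact for the free algebra μ_X, and T(η_X) ⊣ μ_X,
-- whose counit is T(η_X) ∘ μ_X = μ_X ∘ T²(η_X) ≤ μ_X ∘ T(η_{T X}) = id.
-- The (co)algebra equations are monad laws and naturality squares
-- transported along T.

module PosetCategoryProperties {o h r} (𝒜 : PosetCategory o h r) where
  open PosetCategory 𝒜

  ≤-reflexive : ∀ {A B} {f g : Hom A B} → f ≡ g → f ≤ g
  ≤-reflexive refl = ≤-refl

  ∘-monoʳ : ∀ {A B C} (g : Hom B C) {f f′ : Hom A B} → f ≤ f′ → g ∘ f ≤ g ∘ f′
  ∘-monoʳ g = ∘-mono ≤-refl

  retract⇒⊣ : ∀ {A B} {f : Hom A B} {g : Hom B A} → id ≤ g ∘ f → f ∘ g ≡ id → _⊣_ 𝒜 f g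
  retract⇒⊣ u c = record { unit = u ; counit = ≤-reflexive c }

  section⇒⊣ : ∀ {A B} {f : Hom A B} {g : Hom B A} → id ≡ g ∘ f → f ∘ g ≤ id → _⊣_ 𝒜 f g
  section⇒⊣ u c = record { unit = ≤-reflexive u ; counit = c }

module MonadProperties {o h r} (𝒜 : PosetCategory o h r) (M : Monad 𝒜) where
  open PosetCategory 𝒜
  open Monad M

  T-resp-square : ∀ {A B B′ C} {g : Hom B C} {f : Hom A B} {k : Hom B′ C} {l : Hom A B′} →
                  g ∘ f ≡ k ∘ l → T₁ g ∘ T₁ f ≡ T₁ k ∘ T₁ l
  T-resp-square {g = g} {f} {k} {l} eq = begin
    T₁ g ∘ T₁ f  ≡⟨ sym (T-∘ g f) ⟩
    T₁ (g ∘ f)   ≡⟨ cong T₁ eq ⟩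
    T₁ (k ∘ l)   ≡⟨ T-∘ k l ⟩
    T₁ k ∘ T₁ l  ∎
    where open ≡-Reasoning

  T-resp-retract : ∀ {A B} {g : Hom B A} {f : Hom A B} → g ∘ f ≡ id → T₁ g ∘ T₁ f ≡ id
  T-resp-retract {g = g} {f} eq = begin
    T₁ g ∘ T₁ f  ≡⟨ sym (T-∘ g f) ⟩
    T₁ (g ∘ f)   ≡⟨ cong T₁ eq ⟩
    T₁ id        ≡⟨ T-id ⟩
    id           ∎
    where open ≡-Reasoning

  μ-isAlg : ∀ X → IsAlg 𝒜 M (T₀ X) (μ X)
  μ-isAlg X = record { alg-unit = μ-ηˡ X ; alg-assoc = μ-assoc X }

  Tη-isCoalg̅ : ∀ X → IsCoalg̅ 𝒜 M (T₀ X) (μ X) (T₁ (η X))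
  Tη-isCoalg̅ X = record
    { coalg-hom    = sym (μ-nat (η X))
    ; coalg-counit = μ-ηʳ X
    ; coalg-comult = T-resp-square (η-nat (η X))
    }

  T-isAlg̿ : ∀ {X} {a : Hom (T₀ X) X} → IsAlg 𝒜 M X a →
            IsAlg̿ 𝒜 M (T₀ X) (μ X) (T₁ (η X)) (T₁ a)
  T-isAlg̿ {a = a} alg = record
    { alg̿-hom₁ = μ-nat a
    ; alg̿-hom₂ = T-resp-square (η-nat a)
    ; alg̿-unit  = T-resp-retract (IsAlg.alg-unit alg)
    ; alg̿-assoc = T-resp-square (IsAlg.alg-assoc alg)
    }

  T-isAlg̿Map : ∀ {X Z} {a : Hom (T₀ X) X} {b : Hom (T₀ Z) Z} {f : Hom X Z} →
               IsAlgMap 𝒜 M a b f →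
               IsAlg̿Map 𝒜 M (μ X) (T₁ (η X)) (T₁ a) (μ Z) (T₁ (η Z)) (T₁ b) (T₁ f)
  T-isAlg̿Map {f = f} fm = (sym (μ-nat f) , T-resp-square (η-nat f)) , T-resp-square fm

module KZProperties {o h r} (𝒜 : PosetCategory o h r) (M : Monad 𝒜) (kz : IsKZ 𝒜 M) where
  open PosetCategory 𝒜
  open Monad M
  open IsKZ kz
  open PosetCategoryProperties 𝒜
  open MonadProperties 𝒜 M

  alg⊣η : ∀ {X} {a : Hom (T₀ X) X} → IsAlg 𝒜 M X a → _⊣_ 𝒜 a (η X)
  alg⊣η {X} {a} alg = retract⇒⊣ id≤η∘a (IsAlg.alg-unit alg)
    where
    id≤η∘a : id ≤ η X ∘ a
    id≤η∘a = subst₂ _≤_ (T-resp-retract (IsAlg.alg-unit alg)) (sym (η-nat a))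
                       (∘-monoʳ (T₁ a) (Tη≤ηT X))

  T-resp-⊣ : ∀ {A B} {f : Hom A B} {g : Hom B A} → _⊣_ 𝒜 f g → _⊣_ 𝒜 (T₁ f) (T₁ g)
  T-resp-⊣ {f = f} {g} f⊣g = record
    { unit   = subst₂ _≤_ T-id (T-∘ g f) (T-mono (_⊣_.unit f⊣g))
    ; counit = subst₂ _≤_ (T-∘ f g) T-id (T-mono (_⊣_.counit f⊣g))
    }

  Tη⊣μ : ∀ X → _⊣_ 𝒜 (T₁ (η X)) (μ X)
  Tη⊣μ X = section⇒⊣ (sym (μ-ηʳ X)) Tη∘μ≤id
    where
    Tη∘μ≤id : T₁ (η X) ∘ μ X ≤ id
    Tη∘μ≤id = subst₂ _≤_ (μ-nat (η X)) (μ-ηʳ (T₀ X))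
                        (∘-monoʳ (μ (T₀ X)) (T-mono (Tη≤ηT X)))

lemma4p4 : ∀ {o h r : Level} (𝒜 : PosetCategory o h r) (M : Monad 𝒜) → IsKZ 𝒜 M →
    let open PosetCategory 𝒜
        open Monad M
    in (∀ (X : Obj) (a : Hom (T₀ X) X) → IsAlg 𝒜 M X a →
          -- chain of (co)reflections T(a) ⊣ T(η_X) ⊣ μ_X ⊣ η_{T X}
          (_⊣_ 𝒜 (T₁ a) (T₁ (η X)) × _⊣_ 𝒜 (T₁ (η X)) (μ X) × _⊣_ 𝒜 (μ X) (η (T₀ X)))
          -- explicit form
          × (T₁ a ∘ T₁ (η X) ≡ id) × (id ≤ T₁ (η X) ∘ T₁ a)
          × (μ X ∘ T₁ (η X) ≡ id) × (T₁ (η X) ∘ μ X ≤ id)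
          × (μ X ∘ η (T₀ X) ≡ id) × (id ≤ η (T₀ X) ∘ μ X)
          -- μ_X is a T-algebra, T(η_X) a T̄-coalgebra on it,
          -- and T(a) a T̿-algebra on that coalgebra
          × IsAlg 𝒜 M (T₀ X) (μ X)
          × IsCoalg̅ 𝒜 M (T₀ X) (μ X) (T₁ (η X))
          × IsAlg̿ 𝒜 M (T₀ X) (μ X) (T₁ (η X)) (T₁ a))
       -- functor T : Alg(T) → Alg(T̿) on morphisms, and functoriality
       × (∀ (X Z : Obj) (a : Hom (T₀ X) X) (b : Hom (T₀ Z) Z) (f : Hom X Z) →
            IsAlg 𝒜 M X a → IsAlg 𝒜 M Z b → IsAlgMap 𝒜 M a b f →
            IsAlg̿Map 𝒜 M (μ X) (T₁ (η X)) (T₁ a) (μ Z) (T₁ (η Z)) (T₁ b) (T₁ f))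
       × (∀ (X : Obj) → T₁ (id {X}) ≡ id)
       × (∀ (X Y Z : Obj) (g : Hom Y Z) (f : Hom X Y) → T₁ (g ∘ f) ≡ T₁ g ∘ T₁ f)
lemma4p4 𝒜 M kz =
    (λ X a alg →
      let Ta⊣Tη = T-resp-⊣ (alg⊣η alg)
          μ⊣ηT  = alg⊣η (μ-isAlg X)
      in  (Ta⊣Tη , Tη⊣μ X , μ⊣ηT)
        , T-resp-retract (IsAlg.alg-unit alg) , _⊣_.unit Ta⊣Tη
        , μ-ηʳ X , _⊣_.counit (Tη⊣μ X)
        , μ-ηˡ X , _⊣_.unit μ⊣ηT
        , μ-isAlg X , Tη-isCoalg̅ X , T-isAlg̿ alg)
  , (λ _ _ _ _ _ _ _ fm → T-isAlg̿Map fm)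
  , (λ _ → T-id)
  , (λ _ _ _ → T-∘)
  where
  open Monad M
  open MonadProperties 𝒜 M
  open KZProperties 𝒜 M kz
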